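{- Let $B$ be a finite block of continued fraction digits, and let $b\ge2$, $m\ge1$ be integers with $\frac{q(B)}{b}\le m^2<q(B)$. Let $B_1$ be the prefix of $B$ with $r_{B_1}=r_B(m)$ and let $B_2$ be the suffix of $B$ with $r_{B_2^*}=r_{B^*}(m)$. Then \[ -4\left\lceil\tfrac12\log_2 b\right\rceil-5\le |B_1|+|B_2|-|B|\le 1. \]
   Context: A block is a finite sequence $B=a_1\dots a_n$ of positive integers, $|B|=n$, and $B^*=a_n\dots a_1$ is its reversal; the empty block $\wedge$ is allowed. $r_B=1/(a_1+1/(a_2+\dots+1/a_n))$, $r_\wedge=0/1$, and $q(B)$ is the denominator of $r_B$ in lowest terms. $r_B(m)$ denotes $r_{B'}$ where $B'$ is the longest prefix of $B$ with $q(B')\le m$ (so $r_B(m)=0/1$ if $a_1>m$). -}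

module Defs where

open import Data.Nat as ℕ using (ℕ; zero; suc; _≤_; _≤?_; _+_; _*_)
open import Data.Nat.Logarithm using (⌈log₂_⌉)
open import Data.Integer as ℤ using (+_; -[1+_])
open import Data.Rational as ℚ using (ℚ; mkℚ; 0ℚ; 1/_; ↧ₙ_)
open import Data.List using (List; []; _∷_; take; reverse; length)
open import Relation.Nullary using (yes; no)

-- A block: finite list of continued-fraction digits (positivity is a
-- separate hypothesis, see `Block`).
Block : Set
Block = List ℕ

-- Total reciprocal on ℚ (1/0 := 0); only ever applied to positive values
-- for blocks of positive digits.
recip : ℚ → ℚ
recip p@(mkℚ (+ zero) _ _)    = 0ℚ
recip p@(mkℚ (+ suc n) _ _)   = 1/ p
recip p@(mkℚ -[1+ n ] _ _)    = 1/ p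

r : Block → ℚ
r []      = 0ℚ
r (a ∷ B) = recip (ℚ._+_ ((+ a) ℚ./ 1) (r B))

q : Block → ℕ
q B = ↧ₙ (r B)

prefLen : ℕ → Block → ℕ
prefLen m B = go (length B)
  where
  go : ℕ → ℕ
  go zero    = zero
  go (suc k) with q (take (suc k) B) ≤? m
  ... | yes _ = suc k
  ... | no  _ = go k

rm : Block → ℕ → ℚ
rm B m = r (take (prefLen m B) B)

_* : Block → Block
B * = reverse B

-- ⌈ (1/2) log₂ b ⌉  (= ⌈ ⌈log₂ b⌉ / 2 ⌉)
⌈½log₂_⌉ : ℕ → ℕ
⌈½log₂ b ⌉ = ℕ.⌈ ⌈log₂ b ⌉ /2⌉

-- With K Euler's continuant, r U = Kᵗ U / K U in lowest terms, so r separates a block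
-- from its proper extensions and B₁, B₂ are the longest prefix and suffix of B whose
-- continuant is at most m. Continuants are supermultiplicative, K X · K Y ≤ K (X ++ Y),
-- and across a nonempty overlap O they satisfy K (X ++ O ++ Y) ≤ K (X ++ O) · K (O ++ Y).
-- Hence if B₁ and B₂ overlapped, K B ≤ m² would follow, so |B₁| + |B₂| ≤ |B|. Otherwise
-- B = B₁ a M c B₂, and maximality gives K B ≥ K (B₁ a) · K M · K (c B₂) > m² · K M; since
-- K M ≥ 2^(|M|/2) and K B ≤ b m², the gap M is shorter than 2⌈log₂ b⌉.

module Submission where

open import Defs
open import Data.Nat using (ℕ; _≤_; _<_; _+_; _*_; _^_; NonZero)
open import Data.List using (List; _++_; length)
open import Data.List.Relation.Unary.All using (All)
open import Data.Product using (∃; _×_)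
open import Data.Rational using (ℚ)
open import Relation.Binary.PropositionalEquality using (_≡_)

open import Data.Nat using (zero; suc; _∸_; _≤?_; z≤n; s≤s; s≤s⁻¹; _≰_; ⌈_/2⌉; ⌊_/2⌋;
  >-nonZero; >-nonZero⁻¹)
open import Data.Nat.Properties
open import Data.Nat.Coprimality as Coprime using (Coprime)
open import Data.Nat.Divisibility using (∣m+n∣m⇒∣n; n∣m*n; ∣-trans)
open import Data.Nat.Induction using (<-rec)
open import Data.Nat.Logarithm using (⌈log₂_⌉; ⌈log₂⌈n/2⌉⌉≡⌈log₂n⌉∸1; ⌈log₂⌉-mono-≤)
open import Data.Nat.Tactic.RingSolver using (solve-∀)
import Data.Integer as ℤ
import Data.Integer.Properties as ℤₚ
import Data.Rational as ℚ
open import Data.Rational using (mkℚ)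
open import Data.Rational.Properties using (normalize-coprime; /-cong)
open import Data.List using ([]; _∷_; [_]; _∷ʳ_; take; reverse; initLast; _∷ʳ′_)
open import Data.List.Properties using (++-assoc; length-++; length-++-≤ˡ; ∷-injective; reverse-++; unfold-reverse)
open import Data.List.Relation.Unary.All using ([]; _∷_)
open import Data.List.Relation.Unary.All.Properties using (take⁺; ++⁻ˡ; ++⁻ʳ; ∷ʳ⁺)
open import Data.Product using (Σ; _,_; proj₁; proj₂)
open import Data.Sum using (inj₁; inj₂)
open import Relation.Nullary using (yes; no; contradiction)
open import Relation.Binary.PropositionalEquality using (refl; sym; trans; cong; cong₂; subst; subst₂; _≢_; module ≡-Reasoning)

-- Kᵗ U and Kⁱ U are the continuants of U with its first, respectively last, digit
-- deleted (both 0 for the empty block).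
K : List ℕ → ℕ
K []          = 1
K (a ∷ [])    = a
K (a ∷ b ∷ U) = a * K (b ∷ U) + K U

Kᵗ : List ℕ → ℕ
Kᵗ []      = 0
Kᵗ (_ ∷ U) = K U

Kⁱ : List ℕ → ℕ
Kⁱ []          = 0
Kⁱ (a ∷ [])    = 1
Kⁱ (a ∷ b ∷ U) = a * Kⁱ (b ∷ U) + Kⁱ U

K-∷ : ∀ a U → K (a ∷ U) ≡ a * K U + Kᵗ U
K-∷ a []      = sym (trans (+-identityʳ (a * 1)) (*-identityʳ a))
K-∷ a (b ∷ U) = refl

coprime-*+ : ∀ a {t d} → Coprime t d → Coprime (a * d + t) d
coprime-*+ a t⊥d (g∣a*d+t , g∣d) = t⊥d (∣m+n∣m⇒∣n g∣a*d+t (∣-trans g∣d (n∣m*n a)) , g∣d)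

+-mkℚ : ∀ a t d .(c : Coprime t (suc d)) →
  (ℤ.+ a) ℚ./ 1 ℚ.+ mkℚ (ℤ.+ t) d c ≡ mkℚ (ℤ.+ (a * suc d + t)) d (coprime-*+ a c)
+-mkℚ a t d c = begin
  (ℤ.+ a) ℚ./ 1 ℚ.+ mkℚ (ℤ.+ t) d c
    ≡⟨ cong (ℚ._+ mkℚ (ℤ.+ t) d c) (normalize-coprime (Coprime.sym (Coprime.1-coprimeTo a))) ⟩
  (ℤ.+ a ℤ.* ℤ.+ suc d ℤ.+ ℤ.+ t ℤ.* ℤ.+ 1) ℚ./ (1 * suc d)
    ≡⟨ /-cong numerator (*-identityˡ (suc d)) ⟩
  ℤ.+ (a * suc d + t) ℚ./ suc d
    ≡⟨ normalize-coprime (coprime-*+ a c) ⟩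
  mkℚ (ℤ.+ (a * suc d + t)) d (coprime-*+ a c) ∎
  where
  open ≡-Reasoning
  numerator : ℤ.+ a ℤ.* ℤ.+ suc d ℤ.+ ℤ.+ t ℤ.* ℤ.+ 1 ≡ ℤ.+ (a * suc d + t)
  numerator = trans (cong₂ ℤ._+_ (sym (ℤₚ.pos-* a (suc d))) (ℤₚ.*-identityʳ (ℤ.+ t))) (sym (ℤₚ.pos-+ (a * suc d) t))

r-continuants : ∀ U → All NonZero U → ℚ.↥ (r U) ≡ ℤ.+ Kᵗ U × ℚ.↧ₙ (r U) ≡ K U
r-continuants []          []       = refl , refl
r-continuants (suc a ∷ V) (_ ∷ ps) with r V | r-continuants V ps
... | mkℚ _ d c | refl , 1+d≡KV rewrite +-mkℚ (suc a) (Kᵗ V) d c =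
  cong ℤ.+_ 1+d≡KV , trans (cong (λ k → suc a * k + Kᵗ V) 1+d≡KV) (sym (K-∷ (suc a) V))

q≡K : ∀ U → All NonZero U → q U ≡ K U
q≡K U ps = proj₂ (r-continuants U ps)

K-++ : ∀ U V → K (U ++ V) ≡ K U * K V + Kⁱ U * Kᵗ V
K-++ []          V = sym (trans (+-identityʳ (K V + 0)) (+-identityʳ (K V)))
K-++ (a ∷ [])    V = trans (K-∷ a V) (cong (a * K V +_) (sym (+-identityʳ (Kᵗ V))))
K-++ (a ∷ b ∷ U) V = trans (cong₂ (λ x y → a * x + y) (K-++ (b ∷ U) V) (K-++ U V))
  (regroup a (K (b ∷ U)) (Kⁱ (b ∷ U)) (K U) (Kⁱ U) (K V) (Kᵗ V))
  where
  regroup : ∀ a x y z w u v → a * (x * u + y * v) + (z * u + w * v) ≡ (a * x + z) * u + (a * y + w) * v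
  regroup = solve-∀

K-∷ʳ : ∀ U a → K (U ∷ʳ a) ≡ a * K U + Kⁱ U
K-∷ʳ U a = trans (K-++ U [ a ]) (cong₂ _+_ (*-comm (K U) a) (*-identityʳ (Kⁱ U)))

Kⁱ-∷ʳ : ∀ U a → Kⁱ (U ∷ʳ a) ≡ K U
Kⁱ-∷ʳ []          a = refl
Kⁱ-∷ʳ (x ∷ [])    a = trans (+-identityʳ (x * 1)) (*-identityʳ x)
Kⁱ-∷ʳ (x ∷ y ∷ U) a = cong₂ (λ u v → x * u + v) (Kⁱ-∷ʳ (y ∷ U) a) (Kⁱ-∷ʳ U a)

mutual
  K-reverse : ∀ U → K (reverse U) ≡ K U
  K-reverse []      = refl
  K-reverse (a ∷ U) = begin
    K (reverse (a ∷ U))                 ≡⟨ cong K (unfold-reverse a U) ⟩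
    K (reverse U ∷ʳ a)                  ≡⟨ K-∷ʳ (reverse U) a ⟩
    a * K (reverse U) + Kⁱ (reverse U)  ≡⟨ cong₂ (λ x y → a * x + y) (K-reverse U) (Kⁱ-reverse U) ⟩
    a * K U + Kᵗ U                      ≡⟨ K-∷ a U ⟨
    K (a ∷ U)                           ∎
    where open ≡-Reasoning

  Kⁱ-reverse : ∀ U → Kⁱ (reverse U) ≡ Kᵗ U
  Kⁱ-reverse []      = refl
  Kⁱ-reverse (a ∷ U) = trans (cong Kⁱ (unfold-reverse a U)) (trans (Kⁱ-∷ʳ (reverse U) a) (K-reverse U))

K-pos : ∀ U → All NonZero U → 0 < K U
K-pos []          _               = s≤s z≤n
K-pos (a ∷ [])    (nz ∷ _)        = >-nonZero⁻¹ a {{nz}}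
K-pos (a ∷ b ∷ U) (nz ∷ ps)       =
  ≤-trans (K-pos (b ∷ U) ps) (≤-trans (m≤n*m (K (b ∷ U)) a {{nz}}) (m≤m+n _ _))

Kⁱ-pos : ∀ y Y → All NonZero (y ∷ Y) → 0 < Kⁱ (y ∷ Y)
Kⁱ-pos y []      _         = s≤s z≤n
Kⁱ-pos y (b ∷ U) (nz ∷ ps) =
  ≤-trans (Kⁱ-pos b U ps) (≤-trans (m≤n*m (Kⁱ (b ∷ U)) y {{nz}}) (m≤m+n _ _))

Kⁱ≤K : ∀ U → All NonZero U → Kⁱ U ≤ K U
Kⁱ≤K []          _                = z≤n
Kⁱ≤K (a ∷ [])    (nz ∷ _)         = >-nonZero⁻¹ a {{nz}}
Kⁱ≤K (a ∷ b ∷ U) (_ ∷ ps@(_ ∷ qs)) = +-mono-≤ (*-monoʳ-≤ a (Kⁱ≤K (b ∷ U) ps)) (Kⁱ≤K U qs)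

K≤K-∷ : ∀ a U → NonZero a → K U ≤ K (a ∷ U)
K≤K-∷ a U nz = ≤-trans (m≤n*m (K U) a {{nz}}) (≤-trans (m≤m+n _ _) (≤-reflexive (sym (K-∷ a U))))

K-*-≤-++ : ∀ U V → K U * K V ≤ K (U ++ V)
K-*-≤-++ U V = ≤-trans (m≤m+n _ _) (≤-reflexive (sym (K-++ U V)))

K<K-++-∷ : ∀ y Y a W → All NonZero (y ∷ Y ++ a ∷ W) → K (y ∷ Y) < K (y ∷ Y ++ a ∷ W)
K<K-++-∷ y Y a W ps = begin-strict
  K U                               <⟨ m<m+n (K U) (*-mono-≤ (Kⁱ-pos y Y psU) (K-pos W psW)) ⟩
  K U + Kⁱ U * K W                  ≤⟨ +-monoˡ-≤ _ (m≤m*n (K U) (K (a ∷ W)) {{>-nonZero Ka∷W>0}}) ⟩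
  K U * K (a ∷ W) + Kⁱ U * K W      ≡⟨ K-++ U (a ∷ W) ⟨
  K (U ++ a ∷ W)                    ∎
  where
  open ≤-Reasoning
  U = y ∷ Y
  psU = ++⁻ˡ U ps
  psaW = ++⁻ʳ U ps
  psW = ++⁻ʳ [ a ] psaW
  Ka∷W>0 = K-pos (a ∷ W) psaW

K+Kᵗ≤K-++ : ∀ y Y C → All NonZero (y ∷ Y) → K C + Kᵗ C ≤ K (y ∷ Y ++ C)
K+Kᵗ≤K-++ y Y C ps = ≤-trans
  (+-mono-≤ (m≤n*m (K C) (K (y ∷ Y)) {{>-nonZero (K-pos (y ∷ Y) ps)}})
            (m≤n*m (Kᵗ C) (Kⁱ (y ∷ Y)) {{>-nonZero (Kⁱ-pos y Y ps)}}))
  (≤-reflexive (sym (K-++ (y ∷ Y) C)))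

K-++-overlap : ∀ D y Y C → All NonZero ((D ++ y ∷ Y) ++ C) →
  K ((D ++ y ∷ Y) ++ C) ≤ K (D ++ y ∷ Y) * K (y ∷ Y ++ C)
K-++-overlap D y Y C ps = begin
  K (X ++ C)                  ≡⟨ K-++ X C ⟩
  K X * K C + Kⁱ X * Kᵗ C     ≤⟨ +-monoʳ-≤ (K X * K C) (*-monoˡ-≤ (Kᵗ C) (Kⁱ≤K X psX)) ⟩
  K X * K C + K X * Kᵗ C      ≡⟨ *-distribˡ-+ (K X) (K C) (Kᵗ C) ⟨
  K X * (K C + Kᵗ C)          ≤⟨ *-monoʳ-≤ (K X) (K+Kᵗ≤K-++ y Y C (++⁻ʳ D psX)) ⟩
  K X * K (y ∷ Y ++ C)        ∎
  where
  open ≤-Reasoning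
  X = D ++ y ∷ Y
  psX = ++⁻ˡ X ps

2^≤K : ∀ t M → All NonZero M → 2 * t ≤ length M → 2 ^ t ≤ K M
2^≤K zero    M ps _     = K-pos M ps
2^≤K (suc t) M ps 2t+2≤ = from-2+2t (subst (_≤ length M) (*-suc 2 t) 2t+2≤) ps
  where
  from-2+2t : ∀ {M} → 2 + 2 * t ≤ length M → All NonZero M → 2 ^ suc t ≤ K M
  from-2+2t {a ∷ b ∷ U} (s≤s (s≤s 2t≤)) (nza ∷ nzb ∷ ps) = begin
    2 * 2 ^ t            ≤⟨ *-monoʳ-≤ 2 (2^≤K t U ps 2t≤) ⟩
    K U + (K U + 0)      ≤⟨ +-mono-≤ (K≤K-∷ b U nzb) (≤-reflexive (+-identityʳ (K U))) ⟩
    K (b ∷ U) + K U      ≤⟨ +-monoˡ-≤ (K U) (m≤n*m (K (b ∷ U)) a {{nza}}) ⟩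
    a * K (b ∷ U) + K U  ∎
    where open ≤-Reasoning

n≤2*⌈n/2⌉ : ∀ n → n ≤ 2 * ⌈ n /2⌉
n≤2*⌈n/2⌉ n = begin
  n                          ≡⟨ ⌊n/2⌋+⌈n/2⌉≡n n ⟨
  ⌊ n /2⌋ + ⌈ n /2⌉          ≤⟨ +-monoˡ-≤ ⌈ n /2⌉ (⌊n/2⌋≤⌈n/2⌉ n) ⟩
  ⌈ n /2⌉ + ⌈ n /2⌉          ≡⟨ cong (⌈ n /2⌉ +_) (+-identityʳ ⌈ n /2⌉) ⟨
  2 * ⌈ n /2⌉                ∎
  where open ≤-Reasoning

n≤2^⌈log₂n⌉ : ∀ n → n ≤ 2 ^ ⌈log₂ n ⌉
n≤2^⌈log₂n⌉ = <-rec _ bound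
  where
  bound : ∀ n → (∀ {k} → k < n → k ≤ 2 ^ ⌈log₂ k ⌉) → n ≤ 2 ^ ⌈log₂ n ⌉
  bound zero          _   = z≤n
  bound (suc zero)    _   = s≤s z≤n
  bound n@(suc (suc k)) rec = begin
    n                     ≤⟨ n≤2*⌈n/2⌉ n ⟩
    2 * ⌈ n /2⌉           ≤⟨ *-monoʳ-≤ 2 (rec (⌈n/2⌉<n k)) ⟩
    2 * 2 ^ ⌈log₂ ⌈ n /2⌉ ⌉ ≡⟨ cong (λ e → 2 * 2 ^ e) (⌈log₂⌈n/2⌉⌉≡⌈log₂n⌉∸1 n) ⟩
    2 * 2 ^ (L ∸ 1)       ≡⟨ cong (2 ^_) (m+[n∸m]≡n 1≤L) ⟩
    2 ^ L                 ∎
    where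
    open ≤-Reasoning
    L = ⌈log₂ n ⌉
    1≤L : 1 ≤ L
    1≤L = ⌈log₂⌉-mono-≤ {2} {n} (s≤s (s≤s z≤n))

take-length-++ : ∀ (X Y : List ℕ) → take (length X) (X ++ Y) ≡ X
take-length-++ []      Y = refl
take-length-++ (x ∷ X) Y = cong (x ∷_) (take-length-++ X Y)

take-++-≥ : ∀ (X Y : List ℕ) {k} → length X ≤ k → take k (X ++ Y) ≡ X ++ take (k ∸ length X) Y
take-++-≥ []      Y         _         = refl
take-++-≥ (x ∷ X) Y {suc k} (s≤s X≤k) = cong (x ∷_) (take-++-≥ X Y X≤k)

++-middle : ∀ (X E Y F : List ℕ) → X ++ E ≡ Y ++ F → length X ≤ length Y →
  Σ (List ℕ) λ Z → Y ≡ X ++ Z × E ≡ Z ++ F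
++-middle []      E Y       F eq        _         = Y , refl , eq
++-middle (x ∷ X) E (y ∷ Y) F eq (s≤s X≤Y) with ∷-injective eq
... | refl , eq′ with ++-middle X E Y F eq′ X≤Y
...   | Z , Y≡X++Z , E≡Z++F = Z , cong (x ∷_) Y≡X++Z , E≡Z++F

All-reverse : ∀ {U : List ℕ} → All NonZero U → All NonZero (reverse U)
All-reverse {[]}    []        = []
All-reverse {a ∷ U} (nz ∷ ps) = subst (All NonZero) (sym (unfold-reverse a U)) (∷ʳ⁺ (All-reverse ps) nz)

-- The search loop of `prefLen` is local to `Defs`; this meta is solved by
-- unification against it, which makes the loop available for induction.
mutual
  prefLen-search : ℕ → Block → ℕ → ℕ
  prefLen-search m B = _

  prefLen≡search : ∀ m B → prefLen m B ≡ prefLen-search m B (length B)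
  prefLen≡search m B with length B
  ... | n = refl

search-q≤ : ∀ m B n → 1 ≤ m → q (take (prefLen-search m B n) B) ≤ m
search-q≤ m B zero    1≤m = 1≤m
search-q≤ m B (suc n) 1≤m with q (take (suc n) B) ≤? m
... | yes q≤m = q≤m
... | no  _   = search-q≤ m B n 1≤m

search-maximal : ∀ m B n k → k ≤ n → q (take k B) ≤ m → k ≤ prefLen-search m B n
search-maximal m B zero    k k≤0   _    = k≤0
search-maximal m B (suc n) k k≤1+n qk≤m with q (take (suc n) B) ≤? m
... | yes _   = k≤1+n
... | no  q≰m with m≤n⇒m<n∨m≡n k≤1+n
...   | inj₁ k<1+n = search-maximal m B n k (s≤s⁻¹ k<1+n) qk≤m
...   | inj₂ refl  = contradiction qk≤m q≰m

q-take-prefLen≤ : ∀ m B → 1 ≤ m → q (take (prefLen m B) B) ≤ m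
q-take-prefLen≤ m B 1≤m rewrite prefLen≡search m B = search-q≤ m B (length B) 1≤m

prefix-q≤⇒length≤prefLen : ∀ m V R → q V ≤ m → length V ≤ prefLen m (V ++ R)
prefix-q≤⇒length≤prefLen m V R qV≤m rewrite prefLen≡search m (V ++ R) =
  search-maximal m (V ++ R) (length (V ++ R)) (length V) (length-++-≤ˡ V)
    (subst (λ W → q W ≤ m) (sym (take-length-++ V R)) qV≤m)

r≢r-++-∷ : ∀ U a W → All NonZero (U ++ a ∷ W) → r U ≢ r (U ++ a ∷ W)
r≢r-++-∷ []      a W ps@(_ ∷ psW) rU≡ =
  <⇒≢ (K-pos W psW) (ℤₚ.+-injective (trans (cong ℚ.↥_ rU≡) (proj₁ (r-continuants (a ∷ W) ps))))
r≢r-++-∷ (y ∷ Y) a W ps rU≡ = <⇒≢ (K<K-++-∷ y Y a W ps)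
  (trans (sym (q≡K (y ∷ Y) (++⁻ˡ (y ∷ Y) ps))) (trans (cong ℚ.↧ₙ_ rU≡) (q≡K _ ps)))

record LongestPrefix (m : ℕ) (U B : Block) : Set where
  field
    K≤m    : K U ≤ m
    m<K-∷ʳ : ∀ a R → U ++ a ∷ R ≡ B → m < K (U ∷ʳ a)

record LongestSuffix (m : ℕ) (V B : Block) : Set where
  field
    K≤m   : K V ≤ m
    m<K-∷ : ∀ c R → R ++ c ∷ V ≡ B → m < K (c ∷ V)

rm-longestPrefix : ∀ {m} B U → All NonZero B → 1 ≤ m →
  (∃ λ C → U ++ C ≡ B) → r U ≡ rm B m → LongestPrefix m U B
rm-longestPrefix {m} B U ps 1≤m (C , U++C≡B) rU≡ = record { K≤m = K≤m ; m<K-∷ʳ = m<K-∷ʳ }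
  where
  p = prefLen m B
  P = take p B
  psP = take⁺ p ps
  qP≡KU : q P ≡ K U
  qP≡KU = trans (sym (cong ℚ.↧ₙ_ rU≡)) (q≡K U (++⁻ˡ U (subst (All NonZero) (sym U++C≡B) ps)))
  K≤m : K U ≤ m
  K≤m = subst (_≤ m) qP≡KU (q-take-prefLen≤ m B 1≤m)
  m<K-∷ʳ : ∀ a R → U ++ a ∷ R ≡ B → m < K (U ∷ʳ a)
  m<K-∷ʳ a R U++a∷R≡B = ≰⇒> extension-inadmissible
    where
    X = U ∷ʳ a
    X++R≡B : X ++ R ≡ B
    X++R≡B = trans (++-assoc U [ a ] R) U++a∷R≡B
    W = take (p ∸ length X) R
    -- Otherwise the prefix selected by prefLen properly extends U but has the same value.
    extension-inadmissible : K X ≰ m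
    extension-inadmissible KX≤m = r≢r-++-∷ U a W (subst (All NonZero) P≡U++a∷W psP) (trans rU≡ (cong r P≡U++a∷W))
      where
      qX≤m : q X ≤ m
      qX≤m = subst (_≤ m) (sym (q≡K X (++⁻ˡ X (subst (All NonZero) (sym X++R≡B) ps)))) KX≤m
      X≤p : length X ≤ p
      X≤p = subst (λ B′ → length X ≤ prefLen m B′) X++R≡B (prefix-q≤⇒length≤prefLen m X R qX≤m)
      P≡U++a∷W : P ≡ U ++ a ∷ W
      P≡U++a∷W = trans (cong (take p) (sym X++R≡B)) (trans (take-++-≥ X R X≤p) (++-assoc U [ a ] W))

rm-longestSuffix : ∀ {m} B V → All NonZero B → 1 ≤ m →
  (∃ λ C → C ++ V ≡ B) → r (V *) ≡ rm (B *) m → LongestSuffix m V B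
rm-longestSuffix {m} B V ps 1≤m (C , C++V≡B) rV*≡ = record
  { K≤m   = subst (_≤ m) (K-reverse V) K≤m
  ; m<K-∷ = λ c R R++c∷V≡B → subst (m <_) (K-reverse-∷ c) (m<K-∷ʳ c (reverse R) (reversed R++c∷V≡B))
  }
  where
  open LongestPrefix (rm-longestPrefix (reverse B) (reverse V) (All-reverse ps) 1≤m
    (reverse C , trans (sym (reverse-++ C V)) (cong reverse C++V≡B)) rV*≡)
  K-reverse-∷ : ∀ c → K (reverse V ∷ʳ c) ≡ K (c ∷ V)
  K-reverse-∷ c = trans (cong K (sym (unfold-reverse c V))) (K-reverse (c ∷ V))
  reversed : ∀ {c R} → R ++ c ∷ V ≡ B → reverse V ++ c ∷ reverse R ≡ reverse B
  reversed {c} {R} R++c∷V≡B = begin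
    reverse V ++ c ∷ reverse R     ≡⟨ ++-assoc (reverse V) [ c ] (reverse R) ⟨
    (reverse V ∷ʳ c) ++ reverse R  ≡⟨ cong (_++ reverse R) (unfold-reverse c V) ⟨
    reverse (c ∷ V) ++ reverse R   ≡⟨ reverse-++ R (c ∷ V) ⟨
    reverse (R ++ c ∷ V)           ≡⟨ cong reverse R++c∷V≡B ⟩
    reverse B                      ∎
    where open ≡-Reasoning

prefix+suffix≤length : ∀ {m} B B₁ B₂ → All NonZero B →
  (∃ λ C → B₁ ++ C ≡ B) → (∃ λ D → D ++ B₂ ≡ B) →
  K B₁ ≤ m → K B₂ ≤ m → m * m < K B → length B₁ + length B₂ ≤ length B
prefix+suffix≤length B B₁ B₂ ps (C , refl) (D , D++B₂≡B) K₁≤m K₂≤m m*m<K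
  with ≤-total (length B₁) (length D)
... | inj₁ B₁≤D =
  ≤-trans (+-monoˡ-≤ (length B₂) B₁≤D) (≤-reflexive (trans (sym (length-++ D)) (cong length D++B₂≡B)))
... | inj₂ D≤B₁ with ++-middle D B₂ B₁ C D++B₂≡B D≤B₁
...   | []    , refl , refl = ≤-reflexive (sym (length-++ (D ++ [])))
...   | y ∷ Y , refl , refl =
  contradiction (≤-trans (K-++-overlap D y Y C ps) (*-mono-≤ K₁≤m K₂≤m)) (<⇒≱ m*m<K)

gap-length< : ∀ {b m} .{{_ : NonZero b}} B₁ a M c B₂ → All NonZero (B₁ ++ a ∷ M ++ c ∷ B₂) →
  m < K (B₁ ∷ʳ a) → m < K (c ∷ B₂) → K (B₁ ++ a ∷ M ++ c ∷ B₂) ≤ b * (m * m) →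
  length M < 2 * ⌈log₂ b ⌉
gap-length< {b} {m} B₁ a M c B₂ ps m<K₁ m<K₂ K≤ = ≰⇒> λ 2L≤M → <⇒≱ (b*m*m<K 2L≤M) K≤
  where
  X = B₁ ∷ʳ a
  Y = c ∷ B₂
  psM : All NonZero M
  psM = ++⁻ˡ M (++⁻ʳ [ a ] (++⁻ʳ B₁ ps))
  reorder : ∀ b m → b * (suc m * suc m) ≡ suc m * b * suc m
  reorder = solve-∀
  b*m*m<K : 2 * ⌈log₂ b ⌉ ≤ length M → b * (m * m) < K (B₁ ++ a ∷ M ++ c ∷ B₂)
  b*m*m<K 2L≤M = begin-strict
    b * (m * m)                <⟨ *-monoʳ-< b (*-mono-< (n<1+n m) (n<1+n m)) ⟩
    b * (suc m * suc m)        ≡⟨ reorder b m ⟩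
    suc m * b * suc m          ≤⟨ *-mono-≤ (*-mono-≤ m<K₁ b≤KM) m<K₂ ⟩
    K X * K M * K Y            ≡⟨ *-assoc (K X) (K M) (K Y) ⟩
    K X * (K M * K Y)          ≤⟨ *-monoʳ-≤ (K X) (K-*-≤-++ M Y) ⟩
    K X * K (M ++ Y)           ≤⟨ K-*-≤-++ X (M ++ Y) ⟩
    K (X ++ M ++ Y)            ≡⟨ cong K (++-assoc B₁ [ a ] (M ++ Y)) ⟩
    K (B₁ ++ a ∷ M ++ c ∷ B₂)  ∎
    where
    open ≤-Reasoning
    b≤KM : b ≤ K M
    b≤KM = ≤-trans (n≤2^⌈log₂n⌉ b) (2^≤K ⌈log₂ b ⌉ M psM 2L≤M)

gap-length≤ : ∀ {b m} .{{_ : NonZero b}} B₁ Z B₂ → All NonZero (B₁ ++ Z ++ B₂) →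
  LongestPrefix m B₁ (B₁ ++ Z ++ B₂) → LongestSuffix m B₂ (B₁ ++ Z ++ B₂) →
  K (B₁ ++ Z ++ B₂) ≤ b * (m * m) → length Z ≤ 2 * ⌈log₂ b ⌉ + 1
gap-length≤ B₁ []      B₂ _ _ _ _ = z≤n
gap-length≤ {b} {m} B₁ (a ∷ Z) B₂ ps P S K≤ with initLast Z
... | []       = m≤n+m 1 _
... | M ∷ʳ′ c  = begin
  suc (length (M ∷ʳ c))  ≡⟨ cong suc (length-++ M) ⟩
  suc (length M) + 1     ≤⟨ +-monoˡ-≤ 1 (gap-length< B₁ a M c B₂ ps′ m<K₁ m<K₂ K≤′) ⟩
  2 * ⌈log₂ b ⌉ + 1      ∎
  where
  open ≤-Reasoning
  B≡ : B₁ ++ a ∷ M ++ c ∷ B₂ ≡ B₁ ++ a ∷ (M ∷ʳ c) ++ B₂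
  B≡ = cong (λ T → B₁ ++ a ∷ T) (sym (++-assoc M [ c ] B₂))
  ps′ : All NonZero (B₁ ++ a ∷ M ++ c ∷ B₂)
  ps′ = subst (All NonZero) (sym B≡) ps
  m<K₁ : m < K (B₁ ∷ʳ a)
  m<K₁ = LongestPrefix.m<K-∷ʳ P a (M ++ c ∷ B₂) B≡
  m<K₂ : m < K (c ∷ B₂)
  m<K₂ = LongestSuffix.m<K-∷ S c (B₁ ++ a ∷ M) (trans (++-assoc B₁ (a ∷ M) (c ∷ B₂)) B≡)
  K≤′ : K (B₁ ++ a ∷ M ++ c ∷ B₂) ≤ b * (m * m)
  K≤′ = subst (λ B → K B ≤ b * (m * m)) (sym B≡) K≤

length≤prefix+suffix+gap : ∀ {b m} .{{_ : NonZero b}} B B₁ B₂ → All NonZero B →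
  (∃ λ C → B₁ ++ C ≡ B) → (∃ λ D → D ++ B₂ ≡ B) →
  LongestPrefix m B₁ B → LongestSuffix m B₂ B → K B ≤ b * (m * m) →
  length B ≤ length B₁ + length B₂ + (2 * ⌈log₂ b ⌉ + 1)
length≤prefix+suffix+gap {b} B B₁ B₂ ps (C , refl) (D , D++B₂≡B) P S K≤
  with ≤-total (length D) (length B₁)
... | inj₁ D≤B₁ = begin
  length (B₁ ++ C)          ≡⟨ cong length D++B₂≡B ⟨
  length (D ++ B₂)          ≡⟨ length-++ D ⟩
  length D + length B₂      ≤⟨ +-monoˡ-≤ (length B₂) D≤B₁ ⟩
  length B₁ + length B₂     ≤⟨ m≤m+n _ _ ⟩
  length B₁ + length B₂ + (2 * ⌈log₂ b ⌉ + 1) ∎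
  where open ≤-Reasoning
... | inj₂ B₁≤D with ++-middle B₁ C D B₂ (sym D++B₂≡B) B₁≤D
...   | Z , refl , refl = begin
  length (B₁ ++ Z ++ B₂)
    ≡⟨ length-++ B₁ ⟩
  length B₁ + length (Z ++ B₂)
    ≡⟨ cong (length B₁ +_) (trans (length-++ Z) (+-comm (length Z) (length B₂))) ⟩
  length B₁ + (length B₂ + length Z)
    ≡⟨ +-assoc (length B₁) (length B₂) (length Z) ⟨
  length B₁ + length B₂ + length Z
    ≤⟨ +-monoʳ-≤ (length B₁ + length B₂) (gap-length≤ B₁ Z B₂ ps P S K≤) ⟩
  length B₁ + length B₂ + (2 * ⌈log₂ b ⌉ + 1) ∎
  where open ≤-Reasoning

2n+1≤4⌈n/2⌉+5 : ∀ n → 2 * n + 1 ≤ 4 * ⌈ n /2⌉ + 5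
2n+1≤4⌈n/2⌉+5 n = begin
  2 * n + 1              ≤⟨ +-monoˡ-≤ 1 (*-monoʳ-≤ 2 (n≤2*⌈n/2⌉ n)) ⟩
  2 * (2 * ⌈ n /2⌉) + 1  ≡⟨ cong (_+ 1) (*-assoc 2 2 ⌈ n /2⌉) ⟨
  4 * ⌈ n /2⌉ + 1        ≤⟨ +-monoʳ-≤ (4 * ⌈ n /2⌉) (s≤s z≤n) ⟩
  4 * ⌈ n /2⌉ + 5        ∎
  where open ≤-Reasoning

lemma3p3 : (B : Block) → All NonZero B → (b m : ℕ) → 2 ≤ b → 1 ≤ m →
    q B ≤ b * (m ^ 2) → m ^ 2 < q B →
    (B₁ B₂ : Block) →
    (∃ λ C → B₁ ++ C ≡ B) → r B₁ ≡ rm B m →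
    (∃ λ C → C ++ B₂ ≡ B) → r (B₂ *) ≡ rm (B *) m →
    (length B₁ + length B₂ ≤ length B + 1)
    × (length B ≤ length B₁ + length B₂ + (4 * ⌈½log₂ b ⌉ + 5))
lemma3p3 B ps b m 2≤b 1≤m qB≤bm² m²<qB B₁ B₂ B₁-prefix rB₁≡ B₂-suffix rB₂*≡ =
    ≤-trans (prefix+suffix≤length B B₁ B₂ ps B₁-prefix B₂-suffix
               (LongestPrefix.K≤m P) (LongestSuffix.K≤m S) m*m<KB)
            (m≤m+n _ 1)
  , ≤-trans (length≤prefix+suffix+gap B B₁ B₂ ps B₁-prefix B₂-suffix P S KB≤b*m*m)
            (+-monoʳ-≤ (length B₁ + length B₂) (2n+1≤4⌈n/2⌉+5 ⌈log₂ b ⌉))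
  where
  instance
    b≢0 : NonZero b
    b≢0 = >-nonZero (≤-trans (s≤s z≤n) 2≤b)
  P = rm-longestPrefix B B₁ ps 1≤m B₁-prefix rB₁≡
  S = rm-longestSuffix B B₂ ps 1≤m B₂-suffix rB₂*≡
  m²≡m*m : m ^ 2 ≡ m * m
  m²≡m*m = cong (m *_) (*-identityʳ m)
  m*m<KB : m * m < K B
  m*m<KB = subst₂ _<_ m²≡m*m (q≡K B ps) m²<qB
  KB≤b*m*m : K B ≤ b * (m * m)
  KB≤b*m*m = subst₂ (λ x y → x ≤ b * y) (q≡K B ps) m²≡m*m qB≤bm²
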